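{- Let $\eta\in(0,1)$ and let $2\le s\le t$ be integers. Let $N\ge1$ and suppose $A\subseteq[N]=\{1,\dots,N\}$ satisfies $E_s(1_A,1_{ -A})\le(t+\eta)|A|^s$. Then \[ |A|\le 2\Big(\frac{t^2}{1-\eta}\Big)^{1/s}N^{1-1/s}. \]
   Context: For finitely supported $f,g:\mathbb{Z}\to\mathbb{R}$, $(f*g)(x)=\sum_{y}f(y)g(x-y)$ and $E_s(f,g)=\sum_{n\in\mathbb{Z}}((f*g)(n))^s$; $1_A$, $1_{ -A}$ are the indicator functions of $A$ and $-A=\{ -a:a\in A\}$.
   Formalization: The parameter η ranges over the rationals in the open interval (0,1). -}

module Defs where

open import Data.Nat as ℕ using (ℕ; zero; suc; _<?_)
open import Data.Integer as ℤ using (ℤ; +_; -[1+_])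
open import Data.Fin using (fromℕ<)
open import Data.Fin.Subset using (Subset)
open import Data.Vec using (lookup)
open import Data.Bool using (if_then_else_)
open import Data.Rational using (ℚ; _/_)
open import Relation.Nullary using (yes; no)

sumRange : ℤ → ℕ → (ℤ → ℕ) → ℕ
sumRange lo zero    f = 0
sumRange lo (suc k) f = f lo ℕ.+ sumRange (lo ℤ.+ + 1) k f

-- A ⊆ [N] = {1,…,N} is encoded as A : Subset N, where Fin index i stands
-- for the integer i + 1.  Indicator 1_A : ℤ → ℕ.
ind : ∀ {N} → Subset N → ℤ → ℕ
ind {N} A (+ suc k) with k <? N
... | yes p = if lookup A (fromℕ< p) then 1 else 0
... | no _  = 0
ind A _ = 0

indNeg : ∀ {N} → Subset N → ℤ → ℕ
indNeg A x = ind A (ℤ.- x)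

-- (f * g)(x) = Σ_y f(y) g(x - y), for f supported in [-N, N]
-- (all functions below are supported in [-N, N], so this is the full sum).
conv : ℕ → (ℤ → ℕ) → (ℤ → ℕ) → ℤ → ℕ
conv N f g x = sumRange (ℤ.- (+ N)) (2 ℕ.* N ℕ.+ 1) (λ y → f y ℕ.* g (x ℤ.- y))

-- E_s(1_A, 1_{-A}) = Σ_n ((1_A * 1_{-A})(n))^s ; the convolution is
-- supported in [-2N, 2N], so summing over that interval is the full sum.
Es : ∀ {N} → ℕ → Subset N → ℕ
Es {N} s A = sumRange (ℤ.- (+ (2 ℕ.* N))) (4 ℕ.* N ℕ.+ 1)
               (λ n → (conv N (ind A) (indNeg A) n) ℕ.^ s)

toℚ : ℕ → ℚ
toℚ n = + n / 1

-- Let r(x) = (1_A ∗ 1_{−A})(x) be the number of pairs (a, b) ∈ A² with a − b = x.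
-- Summed over the 2N − 1 integers of [−(N − 1), N − 1] alone, r already totals |A|²,
-- so the power-mean inequality (Σ f)^s ≤ n^(s−1) Σ f^s, a consequence of Chebyshev's
-- sum inequality, gives |A|^(2s) ≤ (2N − 1)^(s−1) E_s(1_A, 1_{−A}).  Together with
-- E_s ≤ (t + η)|A|^s this yields |A|^s ≤ (2N − 1)^(s−1) (t + 1) ≤ 2^s t² N^(s−1),
-- which is stronger than the claim because 1 − η ≤ 1.

module Submission where

open import Defs
open import Data.Nat as ℕ using (ℕ; _≤_; _^_; _∸_)
open import Data.Fin.Subset using (Subset; ∣_∣)

module _ where
  open import Data.Nat using (zero; suc; _+_; _*_; z≤n; s≤s; _<?_)
  open import Data.Nat.Properties
  open import Data.Nat.Tactic.RingSolver using (solve-∀)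
  open import Data.Integer as ℤ using (ℤ; +_; -[1+_])
  import Data.Integer.Properties as ℤ
  import Data.Integer.Tactic.RingSolver as ℤ-Solver
  open import Data.Bool using (true; false; if_then_else_)
  open import Data.Empty using (⊥-elim)
  open import Data.Fin using (fromℕ<)
  open import Data.Product using (_,_)
  open import Data.Vec using ([]; _∷_; lookup)
  open import Relation.Nullary using (yes; no)
  open import Data.Sum using (inj₁; inj₂)
  open import Function using (_∘_)
  open import Relation.Binary.PropositionalEquality

  -- Sums over integer intervals

  sumRange-cong : ∀ lo n {f g : ℤ → ℕ} → f ≗ g → sumRange lo n f ≡ sumRange lo n g
  sumRange-cong lo zero    f≗g = refl
  sumRange-cong lo (suc n) f≗g = cong₂ _+_ (f≗g lo) (sumRange-cong (lo ℤ.+ + 1) n f≗g)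

  sumRange-mono-≤ : ∀ lo n {f g : ℤ → ℕ} → (∀ x → f x ≤ g x) → sumRange lo n f ≤ sumRange lo n g
  sumRange-mono-≤ lo zero    f≤g = z≤n
  sumRange-mono-≤ lo (suc n) f≤g = +-mono-≤ (f≤g lo) (sumRange-mono-≤ (lo ℤ.+ + 1) n f≤g)

  sumRange-++ : ∀ lo m n f → sumRange lo (m + n) f ≡ sumRange lo m f + sumRange (lo ℤ.+ + m) n f
  sumRange-++ lo zero    n f = cong (λ lo′ → sumRange lo′ n f) (sym (ℤ.+-identityʳ lo))
  sumRange-++ lo (suc m) n f = begin
    f lo + sumRange (lo ℤ.+ + 1) (m + n) f
      ≡⟨ cong (_+_ (f lo)) (sumRange-++ (lo ℤ.+ + 1) m n f) ⟩
    f lo + (sumRange (lo ℤ.+ + 1) m f + sumRange (lo ℤ.+ + 1 ℤ.+ + m) n f)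
      ≡⟨ sym (+-assoc (f lo) _ _) ⟩
    sumRange lo (suc m) f + sumRange (lo ℤ.+ + 1 ℤ.+ + m) n f
      ≡⟨ cong (λ lo′ → sumRange lo (suc m) f + sumRange lo′ n f) (ℤ.+-assoc lo (+ 1) (+ m)) ⟩
    sumRange lo (suc m) f + sumRange (lo ℤ.+ + suc m) n f ∎
    where open ≡-Reasoning

  sumRange-snoc : ∀ lo n f → sumRange lo (suc n) f ≡ sumRange lo n f + f (lo ℤ.+ + n)
  sumRange-snoc lo n f = begin
    sumRange lo (suc n) f                        ≡⟨ cong (λ m → sumRange lo m f) (+-comm 1 n) ⟩
    sumRange lo (n + 1) f                        ≡⟨ sumRange-++ lo n 1 f ⟩
    sumRange lo n f + (f (lo ℤ.+ + n) + 0)       ≡⟨ cong (_+_ (sumRange lo n f)) (+-identityʳ _) ⟩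
    sumRange lo n f + f (lo ℤ.+ + n)             ∎
    where open ≡-Reasoning

  sumRange-const : ∀ lo n c → sumRange lo n (λ _ → c) ≡ n * c
  sumRange-const lo zero    c = refl
  sumRange-const lo (suc n) c = cong (_+_ c) (sumRange-const (lo ℤ.+ + 1) n c)

  sumRange-distrib-+ : ∀ lo n f g →
    sumRange lo n (λ x → f x + g x) ≡ sumRange lo n f + sumRange lo n g
  sumRange-distrib-+ lo zero    f g = refl
  sumRange-distrib-+ lo (suc n) f g =
    trans (cong (_+_ (f lo + g lo)) (sumRange-distrib-+ (lo ℤ.+ + 1) n f g))
          (+-+-interchange (f lo) (g lo) _ _)
    where
    +-+-interchange : ∀ a b c d → (a + b) + (c + d) ≡ (a + c) + (b + d)
    +-+-interchange = solve-∀

  *-distribˡ-sumRange : ∀ lo n c f → c * sumRange lo n f ≡ sumRange lo n (λ x → c * f x)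
  *-distribˡ-sumRange lo zero    c f = *-zeroʳ c
  *-distribˡ-sumRange lo (suc n) c f =
    trans (*-distribˡ-+ c (f lo) _) (cong (_+_ (c * f lo)) (*-distribˡ-sumRange (lo ℤ.+ + 1) n c f))

  sumRange-comm : ∀ a m b n (F : ℤ → ℤ → ℕ) →
    sumRange a m (λ x → sumRange b n (F x)) ≡ sumRange b n (λ y → sumRange a m (λ x → F x y))
  sumRange-comm a zero    b n F = sym (trans (sumRange-const b n 0) (*-zeroʳ n))
  sumRange-comm a (suc m) b n F =
    trans (cong (_+_ (sumRange b n (F a))) (sumRange-comm (a ℤ.+ + 1) m b n F))
          (sym (sumRange-distrib-+ b n (F a) _))

  sumRange-shift : ∀ lo n c f → sumRange lo n (λ x → f (x ℤ.+ c)) ≡ sumRange (lo ℤ.+ c) n f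
  sumRange-shift lo zero    c f = refl
  sumRange-shift lo (suc n) c f = cong (_+_ (f (lo ℤ.+ c))) (begin
    sumRange (lo ℤ.+ + 1) n (λ x → f (x ℤ.+ c)) ≡⟨ sumRange-shift (lo ℤ.+ + 1) n c f ⟩
    sumRange (lo ℤ.+ + 1 ℤ.+ c) n f              ≡⟨ cong (λ lo′ → sumRange lo′ n f) (swap lo c) ⟩
    sumRange (lo ℤ.+ c ℤ.+ + 1) n f              ∎)
    where
    open ≡-Reasoning
    swap : ∀ a b → a ℤ.+ + 1 ℤ.+ b ≡ a ℤ.+ b ℤ.+ + 1
    swap = ℤ-Solver.solve-∀

  sumRange-reflect : ∀ lo n f →
    sumRange lo n (f ∘ ℤ.-_) ≡ sumRange (+ 1 ℤ.- (lo ℤ.+ + n)) n f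
  sumRange-reflect lo zero    f = refl
  sumRange-reflect lo (suc n) f = begin
    f (ℤ.- lo) + sumRange (lo ℤ.+ + 1) n (f ∘ ℤ.-_)
      ≡⟨ cong (_+_ (f (ℤ.- lo))) (sumRange-reflect (lo ℤ.+ + 1) n f) ⟩
    f (ℤ.- lo) + sumRange (+ 1 ℤ.- (lo ℤ.+ + 1 ℤ.+ + n)) n f
      ≡⟨ cong₂ (λ x lo′ → f x + sumRange lo′ n f) (top lo (+ n)) (bottom lo (+ n)) ⟩
    f (lo′ ℤ.+ + n) + sumRange lo′ n f
      ≡⟨ +-comm (f (lo′ ℤ.+ + n)) _ ⟩
    sumRange lo′ n f + f (lo′ ℤ.+ + n)
      ≡⟨ sym (sumRange-snoc lo′ n f) ⟩
    sumRange lo′ (suc n) f ∎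
    where
    open ≡-Reasoning
    lo′ = + 1 ℤ.- (lo ℤ.+ + suc n)
    top : ∀ a m → ℤ.- a ≡ + 1 ℤ.- (a ℤ.+ (+ 1 ℤ.+ m)) ℤ.+ m
    top = ℤ-Solver.solve-∀
    bottom : ∀ a m → + 1 ℤ.- (a ℤ.+ + 1 ℤ.+ m) ≡ + 1 ℤ.- (a ℤ.+ (+ 1 ℤ.+ m))
    bottom = ℤ-Solver.solve-∀

  sumRange-subinterval-≤ : ∀ lo a n b f →
    sumRange (lo ℤ.+ + a) n f ≤ sumRange lo (a + (n + b)) f
  sumRange-subinterval-≤ lo a n b f = begin
    sumRange (lo ℤ.+ + a) n f
      ≤⟨ m≤m+n _ _ ⟩
    sumRange (lo ℤ.+ + a) n f + sumRange (lo ℤ.+ + a ℤ.+ + n) b f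
      ≡⟨ sumRange-++ (lo ℤ.+ + a) n b f ⟨
    sumRange (lo ℤ.+ + a) (n + b) f
      ≤⟨ m≤n+m _ _ ⟩
    sumRange lo a f + sumRange (lo ℤ.+ + a) (n + b) f
      ≡⟨ sumRange-++ lo a (n + b) f ⟨
    sumRange lo (a + (n + b)) f ∎
    where open ≤-Reasoning

  -- Chebyshev's sum inequality and power means

  rearrangement-≤ : ∀ {a b c d} → a ≤ b → c ≤ d → a * d + b * c ≤ a * c + b * d
  rearrangement-≤ {a} {b} {c} {d} a≤b c≤d with m≤n⇒∃[o]m+o≡n a≤b | m≤n⇒∃[o]m+o≡n c≤d
  ... | p , refl | q , refl = ≤-trans (m≤m+n _ (p * q)) (≤-reflexive (expand a p c q))
    where
    expand : ∀ a p c q → a * (c + q) + (a + p) * c + p * q ≡ a * c + (a + p) * (c + q)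
    expand = solve-∀

  SimilarlyOrdered : (ℤ → ℕ) → (ℤ → ℕ) → Set
  SimilarlyOrdered f g = ∀ x y → f x ≤ f y → g x ≤ g y

  similarlyOrdered-rearrangement : ∀ {f g} → SimilarlyOrdered f g →
    ∀ x y → f x * g y + g x * f y ≤ f x * g x + f y * g y
  similarlyOrdered-rearrangement {f} {g} f~g x y with ≤-total (f x) (f y)
  ... | inj₁ fx≤fy = subst (λ z → f x * g y + z ≤ f x * g x + f y * g y) (*-comm (f y) (g x))
    (rearrangement-≤ fx≤fy (f~g x y fx≤fy))
  ... | inj₂ fy≤fx = subst₂ _≤_
    (trans (+-comm (f y * g x) (f x * g y)) (cong (_+_ (f x * g y)) (*-comm (f y) (g x))))
    (+-comm (f y * g y) (f x * g x))
    (rearrangement-≤ fy≤fx (f~g y x fy≤fx))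

  chebyshev : ∀ {f g} → SimilarlyOrdered f g → ∀ lo n →
    sumRange lo n f * sumRange lo n g ≤ n * sumRange lo n (λ x → f x * g x)
  chebyshev f~g lo zero    = z≤n
  chebyshev {f} {g} f~g lo (suc n) = begin
    (f lo + F) * (g lo + G)
      ≡⟨ expand (f lo) (g lo) F G ⟩
    f lo * g lo + (f lo * G + g lo * F) + F * G
      ≤⟨ +-mono-≤ (+-monoʳ-≤ (f lo * g lo) cross) (chebyshev f~g lo′ n) ⟩
    f lo * g lo + (n * (f lo * g lo) + H) + n * H
      ≡⟨ collect (f lo * g lo) H n ⟩
    suc n * (f lo * g lo + H) ∎
    where
    open ≤-Reasoning
    lo′ = lo ℤ.+ + 1
    F = sumRange lo′ n f
    G = sumRange lo′ n g
    H = sumRange lo′ n (λ x → f x * g x)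
    expand : ∀ a b F G → (a + F) * (b + G) ≡ a * b + (a * G + b * F) + F * G
    expand = solve-∀
    collect : ∀ c H n → c + (n * c + H) + n * H ≡ suc n * (c + H)
    collect = solve-∀
    cross : f lo * G + g lo * F ≤ n * (f lo * g lo) + H
    cross = begin
      f lo * G + g lo * F
        ≡⟨ cong₂ _+_ (*-distribˡ-sumRange lo′ n (f lo) g) (*-distribˡ-sumRange lo′ n (g lo) f) ⟩
      sumRange lo′ n (λ y → f lo * g y) + sumRange lo′ n (λ y → g lo * f y)
        ≡⟨ sym (sumRange-distrib-+ lo′ n _ _) ⟩
      sumRange lo′ n (λ y → f lo * g y + g lo * f y)
        ≤⟨ sumRange-mono-≤ lo′ n (similarlyOrdered-rearrangement f~g lo) ⟩
      sumRange lo′ n (λ y → f lo * g lo + f y * g y)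
        ≡⟨ sumRange-distrib-+ lo′ n _ _ ⟩
      sumRange lo′ n (λ _ → f lo * g lo) + H
        ≡⟨ cong (_+ H) (sumRange-const lo′ n _) ⟩
      n * (f lo * g lo) + H ∎

  power-mean : ∀ lo n f k → sumRange lo n f ^ suc k ≤ n ^ k * sumRange lo n (λ x → f x ^ suc k)
  power-mean lo n f zero = ≤-reflexive (begin
    sumRange lo n f * 1                ≡⟨ *-identityʳ _ ⟩
    sumRange lo n f                    ≡⟨ sumRange-cong lo n (λ x → *-identityʳ (f x)) ⟨
    sumRange lo n (λ x → f x * 1)      ≡⟨ +-identityʳ _ ⟨
    1 * sumRange lo n (λ x → f x * 1)  ∎)
    where open ≡-Reasoning
  power-mean lo n f (suc k) = begin
    T * T ^ suc k              ≤⟨ *-monoʳ-≤ T (power-mean lo n f k) ⟩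
    T * (n ^ k * U)            ≡⟨ x*[y*z]≡y*[x*z] T (n ^ k) U ⟩
    n ^ k * (T * U)            ≤⟨ *-monoʳ-≤ (n ^ k) (chebyshev (λ x y → ^-monoˡ-≤ (suc k)) lo n) ⟩
    n ^ k * (n * V)            ≡⟨ sym (*-assoc (n ^ k) n V) ⟩
    n ^ k * n * V              ≡⟨ cong (_* V) (*-comm (n ^ k) n) ⟩
    n ^ suc k * V              ∎
    where
    open ≤-Reasoning
    T = sumRange lo n f
    U = sumRange lo n (λ x → f x ^ suc k)
    V = sumRange lo n (λ x → f x ^ suc (suc k))
    x*[y*z]≡y*[x*z] : ∀ x y z → x * (y * z) ≡ y * (x * z)
    x*[y*z]≡y*[x*z] = solve-∀

  ^-distribʳ-* : ∀ m n k → (m * n) ^ k ≡ m ^ k * n ^ k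
  ^-distribʳ-* m n zero    = refl
  ^-distribʳ-* m n (suc k) =
    trans (cong (_*_ (m * n)) (^-distribʳ-* m n k)) (interchange m n (m ^ k) (n ^ k))
    where
    interchange : ∀ a b c d → (a * b) * (c * d) ≡ (a * c) * (b * d)
    interchange = solve-∀

  -- The indicator of A and the difference function

  ind-nonpos : ∀ {N} (A : Subset N) x d → x ℤ.+ + suc d ≡ + 1 → ind A x ≡ 0
  ind-nonpos A (+ zero)  d _ = refl
  ind-nonpos A -[1+ _ ]  d _ = refl
  ind-nonpos A (+ suc k) d h = ⊥-elim (m+1+n≢0 k (suc-injective (ℤ.+-injective h)))

  ind-beyond : ∀ {N} (A : Subset N) m → N ≤ m → ind A (+ suc m) ≡ 0
  ind-beyond {N} A m N≤m with m <? N
  ... | yes m<N = ⊥-elim (<⇒≱ m<N N≤m)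
  ... | no  _   = refl

  ind-sum-nonpos : ∀ {N} (A : Subset N) lo d → lo ℤ.+ + d ≡ + 1 → sumRange lo d (ind A) ≡ 0
  ind-sum-nonpos A lo zero    _ = refl
  ind-sum-nonpos A lo (suc d) h = cong₂ _+_ (ind-nonpos A lo d h)
    (ind-sum-nonpos A (lo ℤ.+ + 1) d (trans (ℤ.+-assoc lo (+ 1) (+ d)) h))

  ind-sum-beyond : ∀ {N} (A : Subset N) m d → N ≤ m → sumRange (+ suc m) d (ind A) ≡ 0
  ind-sum-beyond A m zero    _   = refl
  ind-sum-beyond A m (suc d) N≤m = cong₂ _+_ (ind-beyond A m N≤m)
    (ind-sum-beyond A (m + 1) d (≤-trans N≤m (m≤m+n m 1)))

  ind-tail : ∀ {N} b (A : Subset N) k → ind (b ∷ A) (+ suc (suc k)) ≡ ind A (+ suc k)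
  ind-tail {N} b A k with suc k <? suc N | k <? N
  ... | yes (s≤s k<N) | yes k<N′ =
    cong (λ p → if lookup A (fromℕ< p) then 1 else 0) (≤-irrelevant k<N k<N′)
  ... | yes (s≤s k<N) | no  k≮N  = ⊥-elim (k≮N k<N)
  ... | no  k+1≮N+1   | yes k<N  = ⊥-elim (k+1≮N+1 (s≤s k<N))
  ... | no  _         | no  _    = refl

  ind-sum-tail : ∀ {N} b (A : Subset N) m k →
    sumRange (+ suc (suc k)) m (ind (b ∷ A)) ≡ sumRange (+ suc k) m (ind A)
  ind-sum-tail b A zero    k = refl
  ind-sum-tail b A (suc m) k = cong₂ _+_ (ind-tail b A k) (ind-sum-tail b A m (k + 1))

  ind-sum : ∀ {N} (A : Subset N) → sumRange (+ 1) N (ind A) ≡ ∣ A ∣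
  ind-sum []                  = refl
  ind-sum {suc N} (true  ∷ A) = cong suc (trans (ind-sum-tail true A N 0) (ind-sum A))
  ind-sum {suc N} (false ∷ A) = trans (ind-sum-tail false A N 0) (ind-sum A)

  -- The window [lo, lo + d + N + e) contains [1, N] because lo + d = 1.
  ind-sum-window : ∀ {N} (A : Subset N) lo d e → lo ℤ.+ + d ≡ + 1 →
    sumRange lo (d + (N + e)) (ind A) ≡ ∣ A ∣
  ind-sum-window {N} A lo d e h = begin
    sumRange lo (d + (N + e)) (ind A)
      ≡⟨ sumRange-++ lo d (N + e) (ind A) ⟩
    sumRange lo d (ind A) + sumRange (lo ℤ.+ + d) (N + e) (ind A)
      ≡⟨ cong₂ _+_ (ind-sum-nonpos A lo d h) (cong (λ lo′ → sumRange lo′ (N + e) (ind A)) h) ⟩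
    sumRange (+ 1) (N + e) (ind A)
      ≡⟨ sumRange-++ (+ 1) N e (ind A) ⟩
    sumRange (+ 1) N (ind A) + sumRange (+ suc N) e (ind A)
      ≡⟨ cong₂ _+_ (ind-sum A) (ind-sum-beyond A N e ≤-refl) ⟩
    ∣ A ∣ + 0
      ≡⟨ +-identityʳ ∣ A ∣ ⟩
    ∣ A ∣ ∎
    where open ≡-Reasoning

  ind-sum-conv-range : ∀ {N} (A : Subset N) → sumRange (ℤ.- + N) (2 * N + 1) (ind A) ≡ ∣ A ∣
  ind-sum-conv-range {N} A = trans (cong (λ m → sumRange (ℤ.- + N) m (ind A)) (length N))
    (ind-sum-window A (ℤ.- + N) (suc N) 0 (lower (+ N)))
    where
    length : ∀ N → 2 * N + 1 ≡ suc N + (N + 0)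
    length = solve-∀
    lower : ∀ a → ℤ.- a ℤ.+ (+ 1 ℤ.+ a) ≡ + 1
    lower = ℤ-Solver.solve-∀

  indNeg-translate-sum : ∀ {n} (A : Subset (suc n)) k → k ≤ n →
    sumRange (ℤ.- + n) (suc (n + n)) (λ x → indNeg A (x ℤ.- + suc k)) ≡ ∣ A ∣
  indNeg-translate-sum A k k≤n with m≤n⇒∃[o]m+o≡n k≤n
  ... | j , refl = begin
    sumRange lo L (λ x → ind A (ℤ.- (x ℤ.- y)))
      ≡⟨ sumRange-cong lo L (λ x → cong (ind A) (neg-sub x y)) ⟩
    sumRange lo L (λ x → ind A (ℤ.- x ℤ.+ y))
      ≡⟨ sumRange-reflect lo L (λ z → ind A (z ℤ.+ y)) ⟩
    sumRange lo′ L (λ z → ind A (z ℤ.+ y))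
      ≡⟨ sumRange-shift lo′ L y (ind A) ⟩
    sumRange (lo′ ℤ.+ y) L (ind A)
      ≡⟨ cong (λ m → sumRange (lo′ ℤ.+ y) m (ind A)) (length k j) ⟩
    sumRange (lo′ ℤ.+ y) (j + (suc (k + j) + k)) (ind A)
      ≡⟨ ind-sum-window A (lo′ ℤ.+ y) j k (lower (+ k) (+ j)) ⟩
    ∣ A ∣ ∎
    where
    open ≡-Reasoning
    y = + suc k
    lo = ℤ.- + (k + j)
    L = suc ((k + j) + (k + j))
    lo′ = + 1 ℤ.- (lo ℤ.+ + L)
    neg-sub : ∀ a b → ℤ.- (a ℤ.- b) ≡ ℤ.- a ℤ.+ b
    neg-sub = ℤ-Solver.solve-∀
    length : ∀ k j → suc ((k + j) + (k + j)) ≡ j + (suc (k + j) + k)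
    length = solve-∀
    lower : ∀ a b →
      + 1 ℤ.- (ℤ.- (a ℤ.+ b) ℤ.+ (+ 1 ℤ.+ ((a ℤ.+ b) ℤ.+ (a ℤ.+ b)))) ℤ.+ (+ 1 ℤ.+ a) ℤ.+ b ≡ + 1
    lower = ℤ-Solver.solve-∀

  rDiff : ∀ {N} → Subset N → ℤ → ℕ
  rDiff {N} A = conv N (ind A) (indNeg A)

  ind*indNeg-translate-sum : ∀ {n} (A : Subset (suc n)) y →
    ind A y * sumRange (ℤ.- + n) (suc (n + n)) (λ x → indNeg A (x ℤ.- y)) ≡ ind A y * ∣ A ∣
  ind*indNeg-translate-sum A (+ zero)  = refl
  ind*indNeg-translate-sum A -[1+ _ ]  = refl
  ind*indNeg-translate-sum {n} A (+ suc k) with k <? suc n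
  ... | yes k<1+n@(s≤s k≤n) =
    cong (_*_ (if lookup A (fromℕ< k<1+n) then 1 else 0)) (indNeg-translate-sum A k k≤n)
  ... | no  _ = refl

  rDiff-sum : ∀ {n} (A : Subset (suc n)) →
    sumRange (ℤ.- + n) (suc (n + n)) (rDiff A) ≡ ∣ A ∣ * ∣ A ∣
  rDiff-sum {n} A = begin
    sumRange W L (λ x → sumRange Y M (λ y → ind A y * indNeg A (x ℤ.- y)))
      ≡⟨ sumRange-comm W L Y M (λ x y → ind A y * indNeg A (x ℤ.- y)) ⟩
    sumRange Y M (λ y → sumRange W L (λ x → ind A y * indNeg A (x ℤ.- y)))
      ≡⟨ sumRange-cong Y M (λ y → sym (*-distribˡ-sumRange W L (ind A y) _)) ⟩
    sumRange Y M (λ y → ind A y * sumRange W L (λ x → indNeg A (x ℤ.- y)))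
      ≡⟨ sumRange-cong Y M (ind*indNeg-translate-sum A) ⟩
    sumRange Y M (λ y → ind A y * ∣ A ∣)
      ≡⟨ sumRange-cong Y M (λ y → *-comm (ind A y) ∣ A ∣) ⟩
    sumRange Y M (λ y → ∣ A ∣ * ind A y)
      ≡⟨ sym (*-distribˡ-sumRange Y M ∣ A ∣ (ind A)) ⟩
    ∣ A ∣ * sumRange Y M (ind A)
      ≡⟨ cong (_*_ ∣ A ∣) (ind-sum-conv-range A) ⟩
    ∣ A ∣ * ∣ A ∣ ∎
    where
    open ≡-Reasoning
    W = ℤ.- + n
    L = suc (n + n)
    Y = ℤ.- + suc n
    M = 2 * suc n + 1

  rDiff-pow-sum≤Es : ∀ {n} (A : Subset (suc n)) s →
    sumRange (ℤ.- + n) (suc (n + n)) (λ x → rDiff A x ^ s) ≤ Es s A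
  rDiff-pow-sum≤Es {n} A s = begin
    sumRange (ℤ.- + n) L g                  ≡⟨ cong (λ lo → sumRange lo L g) (lower (+ n)) ⟨
    sumRange (lo ℤ.+ + a) L g               ≤⟨ sumRange-subinterval-≤ lo a L a g ⟩
    sumRange lo (a + (L + a)) g             ≡⟨ cong (λ m → sumRange lo m g) (length n) ⟨
    Es s A                                  ∎
    where
    open ≤-Reasoning
    L = suc (n + n)
    lo = ℤ.- + (2 * suc n)
    a = suc (suc n)
    g = λ x → rDiff A x ^ s
    lower : ∀ b → ℤ.- (+ 2 ℤ.* (+ 1 ℤ.+ b)) ℤ.+ (+ 2 ℤ.+ b) ≡ ℤ.- b
    lower = ℤ-Solver.solve-∀
    length : ∀ n → 4 * suc n + 1 ≡ suc (suc n) + (suc (n + n) + suc (suc n))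
    length = solve-∀

  energy-lower-bound : ∀ {n} (A : Subset (suc n)) k →
    ∣ A ∣ ^ suc k * ∣ A ∣ ^ suc k ≤ suc (n + n) ^ k * Es (suc k) A
  energy-lower-bound {n} A k = begin
    ∣ A ∣ ^ suc k * ∣ A ∣ ^ suc k
      ≡⟨ ^-distribʳ-* ∣ A ∣ ∣ A ∣ (suc k) ⟨
    (∣ A ∣ * ∣ A ∣) ^ suc k
      ≡⟨ cong (_^ suc k) (rDiff-sum A) ⟨
    sumRange W L (rDiff A) ^ suc k
      ≤⟨ power-mean W L (rDiff A) k ⟩
    L ^ k * sumRange W L (λ x → rDiff A x ^ suc k)
      ≤⟨ *-monoʳ-≤ (L ^ k) (rDiff-pow-sum≤Es A (suc k)) ⟩
    L ^ k * Es (suc k) A ∎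
    where
    open ≤-Reasoning
    W = ℤ.- + n
    L = suc (n + n)

  [1+n+n]^k*[t+1]≤2^[1+k]*t^2*[1+n]^k : ∀ n k t → 1 ≤ t →
    suc (n + n) ^ k * (t + 1) ≤ 2 ^ suc k * t ^ 2 * suc n ^ k
  [1+n+n]^k*[t+1]≤2^[1+k]*t^2*[1+n]^k n k t@(suc u) _ = begin
    suc (n + n) ^ k * (t + 1)
      ≤⟨ *-mono-≤ (^-monoˡ-≤ k (m≤m+n _ 1)) (m≤m+n _ (u * (2 * u + 3))) ⟩
    (suc (n + n) + 1) ^ k * (t + 1 + u * (2 * u + 3))
      ≡⟨ cong₂ (λ b c → b ^ k * c) (double n) (square u) ⟩
    (2 * suc n) ^ k * (2 * t ^ 2)        ≡⟨ cong (_* (2 * t ^ 2)) (^-distribʳ-* 2 (suc n) k) ⟩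
    2 ^ k * suc n ^ k * (2 * t ^ 2)      ≡⟨ regroup (2 ^ k) (suc n ^ k) (t ^ 2) ⟩
    2 ^ suc k * t ^ 2 * suc n ^ k        ∎
    where
    open ≤-Reasoning
    double : ∀ n → suc (n + n) + 1 ≡ 2 * suc n
    double = solve-∀
    square : ∀ u → suc u + 1 + u * (2 * u + 3) ≡ 2 * (suc u * (suc u * 1))
    square = solve-∀
    regroup : ∀ p q r → p * q * (2 * r) ≡ 2 * p * r * q
    regroup = solve-∀

-- From ℕ to ℚ

open import Data.Nat using (zero; suc; z≤n; s≤s)
import Data.Nat.Properties as ℕ
open import Data.Integer as ℤ using (+_)
import Data.Integer.Properties as ℤ
import Data.Nat.Coprimality as Coprime
open import Data.Rational
  using (ℚ; 0ℚ; 1ℚ; _+_; _-_; _*_; _<_; mkℚ; _/_; *≤*; NonNegative; Positive; nonNegative)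
  renaming (_≤_ to _≤ℚ_)
open import Data.Rational.Properties
open import Relation.Binary.PropositionalEquality using (_≡_; sym; trans; cong; cong₂)

toℚ≡mkℚ : ∀ n → toℚ n ≡ mkℚ (+ n) 0 (Coprime.sym (Coprime.1-coprimeTo n))
toℚ≡mkℚ n = normalize-coprime (Coprime.sym (Coprime.1-coprimeTo n))

toℚ-homo-* : ∀ m n → toℚ (m ℕ.* n) ≡ toℚ m * toℚ n
toℚ-homo-* m n rewrite toℚ≡mkℚ m | toℚ≡mkℚ n = cong (λ i → i / 1) (ℤ.pos-* m n)

toℚ-homo-+ : ∀ m n → toℚ (m ℕ.+ n) ≡ toℚ m + toℚ n
toℚ-homo-+ m n rewrite toℚ≡mkℚ m | toℚ≡mkℚ n = cong (λ i → i / 1)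
  (trans (ℤ.pos-+ m n) (sym (cong₂ ℤ._+_ (ℤ.*-identityʳ (+ m)) (ℤ.*-identityʳ (+ n)))))

toℚ-mono-≤ : ∀ {m n} → m ≤ n → toℚ m ≤ℚ toℚ n
toℚ-mono-≤ {m} {n} m≤n rewrite toℚ≡mkℚ m | toℚ≡mkℚ n = *≤* (ℤ.*-monoʳ-≤-nonNeg (+ 1) (ℤ.+≤+ m≤n))

toℚ-nonNeg : ∀ n → NonNegative (toℚ n)
toℚ-nonNeg n = normalize-nonNeg n 1

toℚ-pos : ∀ n → Positive (toℚ (suc n))
toℚ-pos n = normalize-pos (suc n) 1

square-cancel-≤ : ∀ q .{{_ : NonNegative q}} a M E →
  a ℕ.* a ≤ M ℕ.* E → toℚ E ≤ℚ q * toℚ a → toℚ a ≤ℚ toℚ M * q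
square-cancel-≤ q zero        M E _     _    =
  nonNegative⁻¹ (toℚ M * q) {{nonNeg*nonNeg⇒nonNeg (toℚ M) {{toℚ-nonNeg M}} q}}
square-cancel-≤ q a@(suc a-1) M E a²≤ME E≤qa = *-cancelʳ-≤-pos (toℚ a) {{toℚ-pos a-1}} (begin
  toℚ a * toℚ a         ≡⟨ toℚ-homo-* a a ⟨
  toℚ (a ℕ.* a)         ≤⟨ toℚ-mono-≤ a²≤ME ⟩
  toℚ (M ℕ.* E)         ≡⟨ toℚ-homo-* M E ⟩
  toℚ M * toℚ E         ≤⟨ *-monoˡ-≤-nonNeg (toℚ M) {{toℚ-nonNeg M}} E≤qa ⟩
  toℚ M * (q * toℚ a)   ≡⟨ *-assoc (toℚ M) q (toℚ a) ⟨
  toℚ M * q * toℚ a     ∎)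
  where open ≤-Reasoning

[1-p]*q≤q : ∀ p q .{{_ : NonNegative p}} .{{_ : NonNegative q}} → (1ℚ - p) * q ≤ℚ q
[1-p]*q≤q p q = begin
  (1ℚ - p) * q   ≤⟨ *-monoʳ-≤-nonNeg q (+-monoʳ-≤ 1ℚ (neg-antimono-≤ (nonNegative⁻¹ p))) ⟩
  (1ℚ + 0ℚ) * q  ≡⟨ cong (_* q) (+-identityʳ 1ℚ) ⟩
  1ℚ * q         ≡⟨ *-identityˡ q ⟩
  q              ∎
  where open ≤-Reasoning

lemma2p4 : (η : ℚ) → 0ℚ < η → η < 1ℚ →
           (s t : ℕ) → 2 ≤ s → s ≤ t →
           (N : ℕ) → 1 ≤ N → (A : Subset N) →
           toℚ (Es s A) ≤ℚ (toℚ t + η) * toℚ (∣ A ∣ ^ s) →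
           (1ℚ - η) * toℚ (∣ A ∣ ^ s) ≤ℚ toℚ (2 ^ s ℕ.* t ^ 2 ℕ.* N ^ (s ∸ 1))
lemma2p4 η 0<η η<1 (suc k) t _ s≤t (suc n) _ A E≤[t+η]a = begin
  (1ℚ - η) * toℚ a
    ≤⟨ [1-p]*q≤q η (toℚ a) {{η-nonNeg}} {{toℚ-nonNeg a}} ⟩
  toℚ a
    ≤⟨ square-cancel-≤ (toℚ t + η) {{t+η-nonNeg}} a M (Es (suc k) A) (energy-lower-bound A k) E≤[t+η]a ⟩
  toℚ M * (toℚ t + η)
    ≤⟨ *-monoˡ-≤-nonNeg (toℚ M) {{toℚ-nonNeg M}} (+-monoʳ-≤ (toℚ t) (<⇒≤ η<1)) ⟩
  toℚ M * (toℚ t + 1ℚ)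
    ≡⟨ cong (toℚ M *_) (toℚ-homo-+ t 1) ⟨
  toℚ M * toℚ (t ℕ.+ 1)
    ≡⟨ toℚ-homo-* M (t ℕ.+ 1) ⟨
  toℚ (M ℕ.* (t ℕ.+ 1))
    ≤⟨ toℚ-mono-≤ ([1+n+n]^k*[t+1]≤2^[1+k]*t^2*[1+n]^k n k t (ℕ.≤-trans (s≤s z≤n) s≤t)) ⟩
  toℚ (2 ^ suc k ℕ.* t ^ 2 ℕ.* suc n ^ k) ∎
  where
  open ≤-Reasoning
  a = ∣ A ∣ ^ suc k
  M = suc (n ℕ.+ n) ^ k
  η-nonNeg : NonNegative η
  η-nonNeg = nonNegative (<⇒≤ 0<η)
  t+η-nonNeg : NonNegative (toℚ t + η)
  t+η-nonNeg = nonNeg+nonNeg⇒nonNeg (toℚ t) {{toℚ-nonNeg t}} η {{η-nonNeg}}
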